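{- Let $P$ be a finite poset with $b$ bottlenecks, and let $\mathcal{S}$ be the set of all convex sets of the double shelling antimatroid of $P$ having exactly one interior point. Then $$\sum_{S\in\mathcal{S}}(-1)^{|S|}=-b.$$
   Context: In the double shelling antimatroid of $P$, the feasible sets are the sets $I\cup J$ where $I$ is an order ideal (down-closed set) and $J$ an order filter (up-closed set) of $P$, and the convex sets are their complements $P-(I\cup J)$. For a convex set $C$, an element $p\in C$ is extreme if $p$ does not lie in the smallest convex set containing $C-p$; the interior of $C$ is the set of non-extreme elements of $C$ (equivalently, the elements of $C$ that are neither minimal nor maximal in $C$). A bottleneck of $P$ is an element that is neither maximal nor minimal in $P$ but is comparable to every element of $P$. -}

module Defs where

open import Level using (0ℓ)
open import Data.Nat using (ℕ)
open import Data.Fin using (Fin)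
open import Data.Fin.Subset using (Subset; _∈_; _∉_; _⊆_; _∪_; ∁; _-_; ∣_∣)
open import Data.Integer using (ℤ; _^_; -_; +_)
open import Data.Integer using () renaming (_+_ to _+ℤ_)
open import Data.List using (List; foldr; map)
open import Data.Product using (Σ; ∃; _×_)
open import Data.Sum using (_⊎_)
open import Relation.Nullary using (¬_)
open import Relation.Binary using (Rel; IsPartialOrder)
open import Relation.Binary.PropositionalEquality using (_≡_)

record FinPoset : Set₁ where
  field
    size : ℕ
    _≤_  : Rel (Fin size) 0ℓ
    isPartialOrder : IsPartialOrder _≡_ _≤_

module _ (P : FinPoset) where
  open FinPoset P

  private
    El = Fin size
    Sub = Subset size

  IsIdeal : Sub → Set
  IsIdeal I = ∀ {x y} → x ≤ y → y ∈ I → x ∈ I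

  IsFilter : Sub → Set
  IsFilter J = ∀ {x y} → x ≤ y → x ∈ J → y ∈ J

  -- convex sets of the double shelling antimatroid: complements of I ∪ J
  IsConvex : Sub → Set
  IsConvex C = Σ Sub λ I → Σ Sub λ J → IsIdeal I × IsFilter J × (C ≡ ∁ (I ∪ J))

  InHull : Sub → El → Set
  InHull X p = ∀ C → IsConvex C → X ⊆ C → p ∈ C

  IsExtreme : Sub → El → Set
  IsExtreme C p = p ∈ C × ¬ InHull (C - p) p

  IsInterior : Sub → El → Set
  IsInterior C p = p ∈ C × ¬ IsExtreme C p

  HasExactlyOneInteriorPoint : Sub → Set
  HasExactlyOneInteriorPoint C = Σ El λ p → IsInterior C p × (∀ q → IsInterior C q → q ≡ p)

  InS : Sub → Set
  InS C = IsConvex C × HasExactlyOneInteriorPoint C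

  IsMaximal : El → Set
  IsMaximal p = ∀ q → p ≤ q → p ≡ q

  IsMinimal : El → Set
  IsMinimal p = ∀ q → q ≤ p → q ≡ p

  IsBottleneck : El → Set
  IsBottleneck p = ¬ IsMaximal p × ¬ IsMinimal p × (∀ q → p ≤ q ⊎ q ≤ p)

sign : ∀ {n} → Subset n → ℤ
sign S = (- (+ 1)) ^ ∣ S ∣

sumℤ : List ℤ → ℤ
sumℤ = foldr _+ℤ_ (+ 0)

-- A set S = T ∪ {p} with p ∉ T is convex with p as its only interior point exactly when T has
-- elements below and above p, every element of T is adjacent to p (nothing lies strictly between
-- them), and no element adjacent to p lies strictly between two elements of T.  Call T ⊆ X free in X
-- if no element of X lies strictly between two elements of T.  Splitting on a minimal element m of
-- X, the signed count χ(X) = Σ (-1)^|T| over the free subsets T of X satisfies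
-- χ(X) = χ(X - m) - χ(Y) with Y ⊆ X - m containing every minimal element of X - m, so by induction
-- χ(X) is 0 for nonempty X and 1 for empty X.  Inclusion-exclusion over "T meets the elements
-- below/above p" turns the contribution of p into -(χ(X₀) - χ(X₁) - χ(X₂) + χ(X₃)), where X₀ is
-- the set of elements adjacent to p and X₁, X₂, X₃ drop from it those below p, above p, or both.
-- An element incomparable with p lies in all four sets, so the contribution vanishes unless p is
-- comparable with everything.  A bottleneck has covers above and below it, so X₀, X₁, X₂ are
-- nonempty while X₃ is empty, and its contribution is -1; any other p contributes 0.

module Submission where

open import Defs
open import Data.Bool using (not; if_then_else_)
open import Data.Empty using (⊥-elim)
open import Data.Fin using (Fin; zero; suc)
open import Data.Fin.Induction using (spo-wellFounded; po-noetherian)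
open import Data.Fin.Properties using (any?; all?; ¬∀⟶∃¬) renaming (_≟_ to _≟ᶠ_)
open import Data.Fin.Subset
  using (Subset; inside; outside; _⊆_; _∪_; _∩_; ∁; _─_; ⁅_⁆; ⊥; ⊤; ∣_∣; Nonempty; Empty)
open import Data.Fin.Subset.Properties
  using ( _∈?_; _⊆?_; nonempty?; ∈⊤; ∉⊥; Empty-unique; ∣⊥∣≡0; ⊆-antisym; p─q⊆p
        ; x∈p∧x≢y⇒x∈p-y; x∈p∩q⁺; x∈p∩q⁻; x∈p∪q⁺; x∈p∪q⁻; x∉p⇒x∈∁p; x∈∁p⇒x∉p
        ; p⊆q⇒∣p∣≤∣q∣; x∈p⇒∣p-x∣<∣p∣ )
open import Data.Integer using (ℤ; 0ℤ; 1ℤ; -_; +_; _+_; _-_; _*_; _^_) renaming (_≟_ to _≟ℤ_)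
open import Data.Integer.Properties
  using ( +-identityˡ; +-identityʳ; +-inverseʳ; +-comm; -1*i≡-i; neg-involutive
        ; +-commutativeSemigroup; +-0-commutativeMonoid; +-0-abelianGroup )
open import Data.Integer.Tactic.RingSolver using (solve-∀)
open import Data.List using (List; []; _∷_; map; length)
import Data.List.Membership.DecPropositional as DecMembership
open import Data.List.Membership.Propositional using () renaming (_∈_ to _∈ᴸ_)
open import Data.List.Relation.Unary.All.Properties using (All¬⇒¬Any)
open import Data.List.Relation.Unary.AllPairs using ([]; _∷_)
open import Data.List.Relation.Unary.Any using (here; there)
open import Data.List.Relation.Unary.Unique.Propositional using (Unique)
open import Data.Nat using (ℕ; zero; suc)
open import Data.Nat.Induction using (<-wellFounded)
import Data.Nat as ℕ
import Data.Nat.Properties as ℕ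
open import Data.Product using (∃-syntax; _×_; _,_; proj₁; proj₂)
open import Data.Sum using (_⊎_; inj₁; inj₂; [_,_])
open import Data.Vec using ([]; _∷_; tabulate; _[_]%=_)
open import Data.Vec.Base using (here; there)
open import Data.Vec.Properties using (≡-dec; lookup∘tabulate; []=⇒lookup; lookup⇒[]=)
import Data.Bool.Properties as Bool
open import Function using (_on_; flip; id)
open import Function.Bundles using (_⇔_; Equivalence)
open import Induction.WellFounded using (WellFounded; Acc; acc)
open import Level using (Level; 0ℓ)
open import Relation.Binary using (Rel; DecidableEquality; IsPartialOrder; IsStrictPartialOrder)
  renaming (Decidable to Decidable₂)
import Relation.Binary.Construct.NonStrictToStrict as ToStrict
import Relation.Binary.Construct.On as On
open import Relation.Binary.PropositionalEquality
  using (_≡_; _≢_; refl; sym; trans; cong; cong₂; subst; module ≡-Reasoning)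
open import Relation.Nullary using (¬_; Dec; yes; no; does)
import Relation.Nullary.Decidable as Dec
open import Relation.Nullary.Decidable
  using (_×-dec_; _⊎-dec_; _→-dec_; ¬?; dec-true; decidable-stable; ¬¬-excluded-middle)
open import Relation.Nullary.Negation using (¬¬-map)
open import Relation.Unary using (Pred; Decidable; _≐_)
open import Relation.Unary.Properties using (_∩?_; ∁?)

open import Algebra.Properties.AbelianGroup +-0-abelianGroup using (identityʳ-unique; inverseʳ-unique)
open import Algebra.Properties.CommutativeMonoid.Sum +-0-commutativeMonoid using (sum; sum-cong-≗; ∑-distrib-+)
open import Algebra.Properties.CommutativeSemigroup +-commutativeSemigroup using (interchange)

-- Subset membership is opened only inside this module: the theorem at the end uses list membership.
module _ where
  open import Data.Fin.Subset using (_∈_; _∉_)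

  private
    variable
      a b c : Level
      A : Set a
      B : Set b
      C : Set c

  -- Iverson brackets and finite sums

  [_]·_ : Dec A → ℤ → ℤ
  [ d ]· z = if does d then z else 0ℤ

  []·-yes : (d : Dec A) → A → ∀ z → [ d ]· z ≡ z
  []·-yes (yes _) _ z = refl
  []·-yes (no ¬a) a z = ⊥-elim (¬a a)

  []·-no : (d : Dec A) → ¬ A → ∀ z → [ d ]· z ≡ 0ℤ
  []·-no (yes a) ¬a z = ⊥-elim (¬a a)
  []·-no (no _) _ z = refl

  []·-cong : (d : Dec A) (e : Dec B) → (A → B) → (B → A) → ∀ z → [ d ]· z ≡ [ e ]· z
  []·-cong (yes a) e f g z = sym ([]·-yes e (f a) z)
  []·-cong (no ¬a) e f g z = sym ([]·-no e (λ b → ¬a (g b)) z)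

  []·-⊎ : (d : Dec A) (e : Dec B) → (A → ¬ B) → ∀ z → [ d ⊎-dec e ]· z ≡ [ d ]· z + [ e ]· z
  []·-⊎ (yes a) (yes b) disj z = ⊥-elim (disj a b)
  []·-⊎ (yes a) (no _) disj z = sym (+-identityʳ z)
  []·-⊎ (no _) e disj z = sym (+-identityˡ ([ e ]· z))

  []·-split : (d : Dec A) (e : Dec B) → ∀ z → [ d ]· z ≡ [ d ×-dec e ]· z + [ d ×-dec ¬? e ]· z
  []·-split (yes _) (yes _) z = sym (+-identityʳ z)
  []·-split (yes _) (no _) z = sym (+-identityˡ z)
  []·-split (no _) e z = refl

  []·-inclusion-exclusion : (d : Dec A) (e : Dec B) (f : Dec C) → ∀ z →
    [ d ×-dec (e ×-dec f) ]· z ≡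
    [ d ]· z - [ d ×-dec ¬? e ]· z - [ d ×-dec ¬? f ]· z + [ d ×-dec (¬? e ×-dec ¬? f) ]· z
  []·-inclusion-exclusion (no _) e f z = refl
  []·-inclusion-exclusion (yes _) (yes _) (yes _) = identity
    where identity : ∀ z → z ≡ z - 0ℤ - 0ℤ + 0ℤ
          identity = solve-∀
  []·-inclusion-exclusion (yes _) (yes _) (no _) = identity
    where identity : ∀ z → 0ℤ ≡ z - 0ℤ - z + 0ℤ
          identity = solve-∀
  []·-inclusion-exclusion (yes _) (no _) (yes _) = identity
    where identity : ∀ z → 0ℤ ≡ z - z - 0ℤ + 0ℤ
          identity = solve-∀
  []·-inclusion-exclusion (yes _) (no _) (no _) = identity
    where identity : ∀ z → 0ℤ ≡ z - z - z + z
          identity = solve-∀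

  []·-neg : (d : Dec A) → ∀ z → [ d ]· (- z) ≡ - ([ d ]· z)
  []·-neg (yes _) z = refl
  []·-neg (no _) z = refl

  sum-ones : (L : List A) → sumℤ (map (λ _ → 1ℤ) L) ≡ + length L
  sum-ones [] = refl
  sum-ones (_ ∷ L) = cong (λ s → 1ℤ + s) (sum-ones L)

  module Summation {A : Set} (∑ : (A → ℤ) → ℤ)
    (∑-cong : ∀ {f g} → (∀ x → f x ≡ g x) → ∑ f ≡ ∑ g)
    (∑-+ : ∀ f g → ∑ (λ x → f x + g x) ≡ ∑ f + ∑ g) where

    ∑-0 : ∑ (λ _ → 0ℤ) ≡ 0ℤ
    ∑-0 = identityʳ-unique _ _ (sym (∑-+ (λ _ → 0ℤ) (λ _ → 0ℤ)))

    ∑-neg : ∀ f → ∑ (λ x → - f x) ≡ - ∑ f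
    ∑-neg f = inverseʳ-unique (∑ f) (∑ (λ x → - f x)) (begin
      ∑ f + ∑ (λ x → - f x)  ≡⟨ sym (∑-+ f (λ x → - f x)) ⟩
      ∑ (λ x → f x - f x)    ≡⟨ ∑-cong (λ x → +-inverseʳ (f x)) ⟩
      ∑ (λ _ → 0ℤ)           ≡⟨ ∑-0 ⟩
      0ℤ                     ∎)
      where open ≡-Reasoning

    ∑-− : ∀ f g → ∑ (λ x → f x - g x) ≡ ∑ f - ∑ g
    ∑-− f g = trans (∑-+ f (λ x → - g x)) (cong (λ s → ∑ f + s) (∑-neg g))

    ∑-[]·-∅ : ∀ {P : Pred A 0ℓ} (P? : Decidable P) → (∀ x → ¬ P x) → (f : A → ℤ) →
              ∑ (λ x → [ P? x ]· f x) ≡ 0ℤ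
    ∑-[]·-∅ P? ¬P f = trans (∑-cong (λ x → []·-no (P? x) (¬P x) (f x))) ∑-0

    module _ (_≟_ : DecidableEquality A) (∑-δ : ∀ a (g : A → ℤ) → ∑ (λ x → [ x ≟ a ]· g x) ≡ g a) where
      open DecMembership _≟_ using () renaming (_∈?_ to _∈ᴸ?_)

      sum-map≡∑ : ∀ (L : List A) → Unique L → (g : A → ℤ) →
                  sumℤ (map g L) ≡ ∑ (λ x → [ x ∈ᴸ? L ]· g x)
      sum-map≡∑ [] [] g = sym (∑-[]·-∅ (_∈ᴸ? []) (λ _ ()) g)
      sum-map≡∑ (y ∷ L) (y∉L ∷ uL) g = begin
        g y + sumℤ (map g L)
          ≡⟨ cong₂ _+_ (sym (∑-δ y g)) (sum-map≡∑ L uL g) ⟩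
        ∑ (λ x → [ x ≟ y ]· g x) + ∑ (λ x → [ x ∈ᴸ? L ]· g x)
          ≡⟨ sym (∑-+ (λ x → [ x ≟ y ]· g x) (λ x → [ x ∈ᴸ? L ]· g x)) ⟩
        ∑ (λ x → [ x ≟ y ]· g x + [ x ∈ᴸ? L ]· g x)
          ≡⟨ ∑-cong split ⟩
        ∑ (λ x → [ x ∈ᴸ? y ∷ L ]· g x) ∎
        where
        open ≡-Reasoning
        split : ∀ x → [ x ≟ y ]· g x + [ x ∈ᴸ? L ]· g x ≡ [ x ∈ᴸ? y ∷ L ]· g x
        split x = trans (sym ([]·-⊎ (x ≟ y) (x ∈ᴸ? L) (λ { refl → All¬⇒¬Any y∉L }) (g x)))
                        ([]·-cong (x ≟ y ⊎-dec x ∈ᴸ? L) (x ∈ᴸ? y ∷ L)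
                                  (λ { (inj₁ e) → here e ; (inj₂ i) → there i })
                                  (λ { (here e) → inj₁ e ; (there i) → inj₂ i }) (g x))

  -- Sums over all subsets and signed counts of families of subsets

  ∑ₛ : ∀ {n} → (Subset n → ℤ) → ℤ
  ∑ₛ {zero} f = f []
  ∑ₛ {suc n} f = ∑ₛ (λ s → f (outside ∷ s)) + ∑ₛ (λ s → f (inside ∷ s))

  ∑ₛ-cong : ∀ {n} {f g : Subset n → ℤ} → (∀ s → f s ≡ g s) → ∑ₛ f ≡ ∑ₛ g
  ∑ₛ-cong {zero} f≗g = f≗g []
  ∑ₛ-cong {suc n} f≗g = cong₂ _+_ (∑ₛ-cong (λ s → f≗g (outside ∷ s))) (∑ₛ-cong (λ s → f≗g (inside ∷ s)))

  ∑ₛ-+ : ∀ {n} (f g : Subset n → ℤ) → ∑ₛ (λ s → f s + g s) ≡ ∑ₛ f + ∑ₛ g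
  ∑ₛ-+ {zero} f g = refl
  ∑ₛ-+ {suc n} f g =
    trans (cong₂ _+_ (∑ₛ-+ f₀ g₀) (∑ₛ-+ f₁ g₁)) (interchange (∑ₛ f₀) (∑ₛ g₀) (∑ₛ f₁) (∑ₛ g₁))
    where
    f₀ f₁ g₀ g₁ : Subset n → ℤ
    f₀ s = f (outside ∷ s)
    f₁ s = f (inside ∷ s)
    g₀ s = g (outside ∷ s)
    g₁ s = g (inside ∷ s)

  module SubsetSum {n : ℕ} = Summation (∑ₛ {n}) ∑ₛ-cong ∑ₛ-+
  open SubsetSum using () renaming (∑-0 to ∑ₛ-0; ∑-neg to ∑ₛ-neg)

  _≟ₛ_ : ∀ {n} → DecidableEquality (Subset n)
  _≟ₛ_ = ≡-dec Bool._≟_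

  ∑ₛ-δ : ∀ {n} (t : Subset n) (g : Subset n → ℤ) → ∑ₛ (λ s → [ s ≟ₛ t ]· g s) ≡ g t
  ∑ₛ-δ [] g = refl
  ∑ₛ-δ {suc n} (outside ∷ t) g =
    trans (cong₂ _+_ (∑ₛ-δ t (λ s → g (outside ∷ s))) (∑ₛ-0 {n})) (+-identityʳ (g (outside ∷ t)))
  ∑ₛ-δ {suc n} (inside ∷ t) g =
    trans (cong₂ _+_ (∑ₛ-0 {n}) (∑ₛ-δ t (λ s → g (inside ∷ s)))) (+-identityˡ (g (inside ∷ t)))

  toggle : ∀ {n} → Fin n → Subset n → Subset n
  toggle m T = T [ m ]%= not

  ∑ₛ-toggle : ∀ {n} (m : Fin n) (f : Subset n → ℤ) → ∑ₛ f ≡ ∑ₛ (λ s → f (toggle m s))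
  ∑ₛ-toggle zero f = +-comm (∑ₛ (λ s → f (outside ∷ s))) (∑ₛ (λ s → f (inside ∷ s)))
  ∑ₛ-toggle (suc m) f = cong₂ _+_ (∑ₛ-toggle m (λ s → f (outside ∷ s))) (∑ₛ-toggle m (λ s → f (inside ∷ s)))

  sign-toggle : ∀ {n} (m : Fin n) (T : Subset n) → sign (toggle m T) ≡ - sign T
  sign-toggle zero (outside ∷ T) = -1*i≡-i (sign T)
  sign-toggle zero (inside ∷ T) = sym (trans (cong -_ (-1*i≡-i (sign T))) (neg-involutive (sign T)))
  sign-toggle (suc m) (outside ∷ T) = sign-toggle m T
  sign-toggle (suc m) (inside ∷ T) = begin
    - 1ℤ * sign (toggle m T)  ≡⟨ -1*i≡-i (sign (toggle m T)) ⟩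
    - sign (toggle m T)       ≡⟨ cong -_ (sign-toggle m T) ⟩
    - - sign T                ≡⟨ cong -_ (sym (-1*i≡-i (sign T))) ⟩
    - (- 1ℤ * sign T)         ∎
    where open ≡-Reasoning

  toggle-∉⇒∈ : ∀ {n} (m : Fin n) {T} → m ∉ T → m ∈ toggle m T
  toggle-∉⇒∈ zero {outside ∷ T} _ = here
  toggle-∉⇒∈ zero {inside ∷ T} m∉T = ⊥-elim (m∉T here)
  toggle-∉⇒∈ (suc m) {_ ∷ T} m∉T = there (toggle-∉⇒∈ m (λ m∈T → m∉T (there m∈T)))

  toggle-∈⇒∉ : ∀ {n} (m : Fin n) {T} → m ∈ toggle m T → m ∉ T
  toggle-∈⇒∉ zero {outside ∷ T} _ ()
  toggle-∈⇒∉ (suc m) {_ ∷ T} (there m∈) (there m∈T) = toggle-∈⇒∉ m m∈ m∈T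

  toggle-≢⁺ : ∀ {n} (m : Fin n) {x T} → x ≢ m → x ∈ T → x ∈ toggle m T
  toggle-≢⁺ zero {zero} x≢m _ = ⊥-elim (x≢m refl)
  toggle-≢⁺ zero {suc x} {_ ∷ T} _ (there x∈T) = there x∈T
  toggle-≢⁺ (suc m) {zero} {_ ∷ T} _ here = here
  toggle-≢⁺ (suc m) {suc x} {_ ∷ T} x≢m (there x∈T) = there (toggle-≢⁺ m (λ e → x≢m (cong suc e)) x∈T)

  toggle-≢⁻ : ∀ {n} (m : Fin n) {x T} → x ≢ m → x ∈ toggle m T → x ∈ T
  toggle-≢⁻ zero {zero} x≢m _ = ⊥-elim (x≢m refl)
  toggle-≢⁻ zero {suc x} {_ ∷ T} _ (there x∈T) = there x∈T
  toggle-≢⁻ (suc m) {zero} {_ ∷ T} _ here = here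
  toggle-≢⁻ (suc m) {suc x} {_ ∷ T} x≢m (there x∈T) = there (toggle-≢⁻ m (λ e → x≢m (cong suc e)) x∈T)

  ∈-toggle⁻ : ∀ {n} (m : Fin n) {x T} → x ∈ toggle m T → x ≡ m ⊎ x ∈ T
  ∈-toggle⁻ m {x} x∈ with x ≟ᶠ m
  ... | yes x≡m = inj₁ x≡m
  ... | no x≢m = inj₂ (toggle-≢⁻ m x≢m x∈)

  χ : ∀ {n} {Q : Pred (Subset n) 0ℓ} → Decidable Q → ℤ
  χ Q? = ∑ₛ λ T → [ Q? T ]· sign T

  module _ {n : ℕ} {Q R : Pred (Subset n) 0ℓ} where

    χ-cong : (Q? : Decidable Q) (R? : Decidable R) → Q ≐ R → χ Q? ≡ χ R?
    χ-cong Q? R? (Q⊆R , R⊆Q) = ∑ₛ-cong λ T → []·-cong (Q? T) (R? T) Q⊆R R⊆Q (sign T)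

    χ-split : (Q? : Decidable Q) (R? : Decidable R) → χ Q? ≡ χ (Q? ∩? R?) + χ (Q? ∩? ∁? R?)
    χ-split Q? R? = trans (∑ₛ-cong λ T → []·-split (Q? T) (R? T) (sign T))
                          (∑ₛ-+ (λ T → [ (Q? ∩? R?) T ]· sign T) (λ T → [ (Q? ∩? ∁? R?) T ]· sign T))

  χ-toggle : ∀ {n} {Q : Pred (Subset n) 0ℓ} (Q? : Decidable Q) (m : Fin n) →
             χ Q? ≡ - χ (λ T → Q? (toggle m T))
  χ-toggle Q? m = trans (∑ₛ-toggle m (λ T → [ Q? T ]· sign T))
                        (trans (∑ₛ-cong flip-sign) (∑ₛ-neg (λ T → [ Q? (toggle m T) ]· sign T)))
    where
    flip-sign : ∀ T → [ Q? (toggle m T) ]· sign (toggle m T) ≡ - ([ Q? (toggle m T) ]· sign T)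
    flip-sign T = trans (cong ([ Q? (toggle m T) ]·_) (sign-toggle m T)) ([]·-neg (Q? (toggle m T)) (sign T))

  χ-unsatisfiable : ∀ {n} {Q : Pred (Subset n) 0ℓ} (Q? : Decidable Q) → (∀ T → ¬ Q T) → χ Q? ≡ 0ℤ
  χ-unsatisfiable Q? ¬Q = SubsetSum.∑-[]·-∅ Q? ¬Q sign

  χ-≡⊥ : ∀ {n} → χ (_≟ₛ ⊥ {n}) ≡ 1ℤ
  χ-≡⊥ {n} = trans (∑ₛ-δ (⊥ {n}) sign) (cong ((- 1ℤ) ^_) (∣⊥∣≡0 n))

  module FinSum {n : ℕ} = Summation (sum {n}) sum-cong-≗ ∑-distrib-+

  ∑ᶠ-δ : ∀ {n} (a : Fin n) (g : Fin n → ℤ) → sum (λ x → [ x ≟ᶠ a ]· g x) ≡ g a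
  ∑ᶠ-δ {suc n} zero g = trans (cong (λ s → g zero + s) (FinSum.∑-0 {n})) (+-identityʳ (g zero))
  ∑ᶠ-δ (suc a) g = trans (+-identityˡ (sum (λ x → [ x ≟ᶠ a ]· g (suc x)))) (∑ᶠ-δ a (λ x → g (suc x)))

  χ-inclusion-exclusion : ∀ {n} {Q R S : Pred (Subset n) 0ℓ}
                          (Q? : Decidable Q) (R? : Decidable R) (S? : Decidable S) →
    χ (Q? ∩? R? ∩? S?) ≡ χ Q? - χ (Q? ∩? ∁? R?) - χ (Q? ∩? ∁? S?) + χ (Q? ∩? ∁? R? ∩? ∁? S?)
  χ-inclusion-exclusion Q? R? S? = trans
    (∑ₛ-cong λ T → []·-inclusion-exclusion (Q? T) (R? T) (S? T) (sign T))
    (trans (∑ₛ-+ (λ T → f₀ T - f₁ T - f₂ T) f₃)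
           (cong (_+ ∑ₛ f₃) (trans (SubsetSum.∑-− (λ T → f₀ T - f₁ T) f₂)
                                  (cong (_- ∑ₛ f₂) (SubsetSum.∑-− f₀ f₁)))))
    where
    f₀ f₁ f₂ f₃ : Subset _ → ℤ
    f₀ T = [ Q? T ]· sign T
    f₁ T = [ (Q? ∩? ∁? R?) T ]· sign T
    f₂ T = [ (Q? ∩? ∁? S?) T ]· sign T
    f₃ T = [ (Q? ∩? ∁? R? ∩? ∁? S?) T ]· sign T

  ∑ₛ-∑ᶠ : ∀ {m n} (h : Fin m → Subset n → ℤ) →
          ∑ₛ (λ S → sum (λ p → h p S)) ≡ sum (λ p → ∑ₛ (h p))
  ∑ₛ-∑ᶠ {zero} {n} h = ∑ₛ-0 {n}
  ∑ₛ-∑ᶠ {suc m} h = trans (∑ₛ-+ (h zero) (λ S → sum (λ p → h (suc p) S)))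
                          (cong (λ s → ∑ₛ (h zero) + s) (∑ₛ-∑ᶠ (λ p → h (suc p))))

  ∑ᶠ-[]·-unique : ∀ {n} {Q : Pred (Fin n) 0ℓ} (Q? : Decidable Q) → (∀ {p q} → Q p → Q q → p ≡ q) →
    ∀ z → sum (λ p → [ Q? p ]· z) ≡ [ any? Q? ]· z
  ∑ᶠ-[]·-unique Q? unique z with any? Q?
  ... | yes (p , Qp) =
    trans (sum-cong-≗ λ q → []·-cong (Q? q) (q ≟ᶠ p) (λ Qq → unique Qq Qp) (λ { refl → Qp }) z)
          (∑ᶠ-δ p (λ _ → z))
  ... | no ∄Q = FinSum.∑-[]·-∅ Q? (λ p Qp → ∄Q (p , Qp)) (λ _ → z)

  -- Free subsets of a finite strict order

  ⟦_⟧ : ∀ {n} {Q : Pred (Fin n) 0ℓ} → Decidable Q → Subset n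
  ⟦ Q? ⟧ = tabulate (λ x → does (Q? x))

  module _ {n} {Q : Pred (Fin n) 0ℓ} (Q? : Decidable Q) where

    ∈⟦⟧⁺ : ∀ {x} → Q x → x ∈ ⟦ Q? ⟧
    ∈⟦⟧⁺ {x} q = lookup⇒[]= x ⟦ Q? ⟧ (trans (lookup∘tabulate _ x) (dec-true (Q? x) q))

    ∈⟦⟧⁻ : ∀ {x} → x ∈ ⟦ Q? ⟧ → Q x
    ∈⟦⟧⁻ {x} x∈ with Q? x | trans (sym (lookup∘tabulate (λ y → does (Q? y)) x)) ([]=⇒lookup x∈)
    ... | yes q | _ = q

  x∉p-x : ∀ {n} {x : Fin n} {p} → x ∉ p ─ ⁅ x ⁆
  x∉p-x {x = zero} {_ ∷ p} ()
  x∉p-x {x = suc x} {_ ∷ p} (there x∈) = x∉p-x x∈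

  x∈p-y⁻ : ∀ {n} {p : Subset n} {x y} → x ∈ p ─ ⁅ y ⁆ → x ∈ p × x ≢ y
  x∈p-y⁻ {p = p} {y = y} x∈p-y = p─q⊆p p ⁅ y ⁆ x∈p-y , λ { refl → x∉p-x x∈p-y }

  module _ {n} {ℓ} {_⊏_ : Rel (Fin n) ℓ} (_⊏?_ : Decidable₂ _⊏_) (wf : WellFounded _⊏_) where

    minimal : ∀ {Q : Pred (Fin n) 0ℓ} → Decidable Q →
              ∀ {x} → Q x → ∃[ m ] (Q m × ∀ {w} → Q w → ¬ w ⊏ m)
    minimal {Q} Q? {x} = go (wf x)
      where
      go : ∀ {x} → Acc _⊏_ x → Q x → ∃[ m ] (Q m × ∀ {w} → Q w → ¬ w ⊏ m)
      go {x} (acc below) qx with any? (λ w → Q? w ×-dec (w ⊏? x))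
      ... | yes (w , qw , w⊏x) = go (below w⊏x) qw
      ... | no ∄w = x , qx , λ qw w⊏x → ∄w (_ , qw , w⊏x)

  module FreeSets {n} {_<_ : Rel (Fin n) 0ℓ} (isSPO : IsStrictPartialOrder _≡_ _<_) (_<?_ : Decidable₂ _<_) where
    open IsStrictPartialOrder isSPO using (irrefl) renaming (trans to <-trans)

    Between : Subset n → Fin n → Fin n → Set
    Between X x y = ∃[ w ] (w ∈ X × x < w × w < y)

    Between? : ∀ X x y → Dec (Between X x y)
    Between? X x y = any? λ w → w ∈? X ×-dec (x <? w ×-dec w <? y)

    Free : Subset n → Pred (Subset n) 0ℓ
    Free X T = T ⊆ X × (∀ x y → x ∈ T → y ∈ T → ¬ Between X x y)

    Free? : ∀ X → Decidable (Free X)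
    Free? X T = T ⊆? X ×-dec all? λ x → all? λ y → x ∈? T →-dec (y ∈? T →-dec ¬? (Between? X x y))

    Empty⇒χ-Free≡1 : ∀ {X} → Empty X → χ (Free? X) ≡ 1ℤ
    Empty⇒χ-Free≡1 {X} empty = trans (χ-cong (Free? X) (_≟ₛ ⊥) (Free⇒⊥ , ⊥⇒Free)) (χ-≡⊥ {n})
      where
      Free⇒⊥ : ∀ {T} → Free X T → T ≡ ⊥
      Free⇒⊥ (T⊆X , _) = Empty-unique λ (t , t∈T) → empty (t , T⊆X t∈T)
      ⊥⇒Free : ∀ {T} → T ≡ ⊥ → Free X T
      ⊥⇒Free refl = (λ x∈⊥ → ⊥-elim (∉⊥ x∈⊥)) , λ x y x∈⊥ → ⊥-elim (∉⊥ x∈⊥)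

    Free-avoiding : ∀ {X} {D : Pred (Fin n) 0ℓ} (D? : Decidable D) →
                    (∀ {x y z} → ¬ D x → ¬ D z → x < y → y < z → ¬ D y) →
                    (λ T → Free X T × ¬ (∃[ t ] (t ∈ T × D t))) ≐ Free (X ∩ ⟦ ∁? D? ⟧)
    Free-avoiding {X} {D} D? ∁D-convex = to , from
      where
      to : ∀ {T} → Free X T × ¬ (∃[ t ] (t ∈ T × D t)) → Free (X ∩ ⟦ ∁? D? ⟧) T
      to ((T⊆X , free) , ∄D) =
        (λ t∈T → x∈p∩q⁺ (T⊆X t∈T , ∈⟦⟧⁺ (∁? D?) λ Dt → ∄D (_ , t∈T , Dt))) ,
        λ x y x∈T y∈T (w , w∈X∩∁D , x<w , w<y) →
          free x y x∈T y∈T (w , proj₁ (x∈p∩q⁻ X _ w∈X∩∁D) , x<w , w<y)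
      from : ∀ {T} → Free (X ∩ ⟦ ∁? D? ⟧) T → Free X T × ¬ (∃[ t ] (t ∈ T × D t))
      from {T} (T⊆X∩∁D , free) =
        ((λ t∈T → proj₁ (x∈p∩q⁻ X _ (T⊆X∩∁D t∈T))) ,
         λ x y x∈T y∈T (w , w∈X , x<w , w<y) → free x y x∈T y∈T
           (w , x∈p∩q⁺ (w∈X , ∈⟦⟧⁺ (∁? D?) (∁D-convex (∁D x∈T) (∁D y∈T) x<w w<y)) , x<w , w<y)) ,
        λ (t , t∈T , Dt) → ∁D t∈T Dt
        where
        ∁D : ∀ {t} → t ∈ T → ¬ D t
        ∁D t∈T = ∈⟦⟧⁻ (∁? D?) (proj₂ (x∈p∩q⁻ X _ (T⊆X∩∁D t∈T)))

    module _ {X m} (m∈X : m ∈ X) (m-min : ∀ {w} → w ∈ X → ¬ w < m) where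

      Free-∌min : (λ T → Free X T × m ∉ T) ≐ Free (X ─ ⁅ m ⁆)
      Free-∌min = to , from
        where
        to : ∀ {T} → Free X T × m ∉ T → Free (X ─ ⁅ m ⁆) T
        to ((T⊆X , free) , m∉T) =
          (λ t∈T → x∈p∧x≢y⇒x∈p-y (T⊆X t∈T) λ { refl → m∉T t∈T }) ,
          λ x y x∈T y∈T (w , w∈X-m , x<w , w<y) → free x y x∈T y∈T (w , proj₁ (x∈p-y⁻ w∈X-m) , x<w , w<y)
        from : ∀ {T} → Free (X ─ ⁅ m ⁆) T → Free X T × m ∉ T
        from (T⊆X-m , free) =
          ((λ t∈T → proj₁ (x∈p-y⁻ (T⊆X-m t∈T))) ,
           λ x y x∈T y∈T (w , w∈X , x<w , w<y) → free x y x∈T y∈T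
             (w , x∈p∧x≢y⇒x∈p-y w∈X (λ { refl → m-min (proj₁ (x∈p-y⁻ (T⊆X-m x∈T))) x<w }) , x<w , w<y)) ,
          λ m∈T → proj₂ (x∈p-y⁻ (T⊆X-m m∈T)) refl

      Y? : Decidable (λ y → y ∈ X ─ ⁅ m ⁆ × ¬ Between X m y)
      Y? y = y ∈? X ─ ⁅ m ⁆ ×-dec ¬? (Between? X m y)

      Y : Subset n
      Y = ⟦ Y? ⟧

      Y⊆X-m : Y ⊆ X ─ ⁅ m ⁆
      Y⊆X-m y∈Y = proj₁ (∈⟦⟧⁻ Y? y∈Y)

      Free-∋min : (λ T → Free X (toggle m T) × m ∈ toggle m T) ≐ Free Y
      Free-∋min = to , from
        where
        to : ∀ {T} → Free X (toggle m T) × m ∈ toggle m T → Free Y T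
        to {T} ((T′⊆X , free) , m∈T′) = T⊆Y , λ x y x∈T y∈T (w , w∈Y , x<w , w<y) →
            free x y (inT′ x∈T) (inT′ y∈T) (w , proj₁ (x∈p-y⁻ (Y⊆X-m w∈Y)) , x<w , w<y)
          where
          m∉T : m ∉ T
          m∉T = toggle-∈⇒∉ m m∈T′
          inT′ : ∀ {t} → t ∈ T → t ∈ toggle m T
          inT′ t∈T = toggle-≢⁺ m (λ { refl → m∉T t∈T }) t∈T
          T⊆Y : T ⊆ Y
          T⊆Y {t} t∈T = ∈⟦⟧⁺ Y? (x∈p∧x≢y⇒x∈p-y (T′⊆X (inT′ t∈T)) (λ { refl → m∉T t∈T }) ,
                                  free m t m∈T′ (inT′ t∈T))
        from : ∀ {T} → Free Y T → Free X (toggle m T) × m ∈ toggle m T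
        from {T} (T⊆Y , free) = (T′⊆X , free′) , toggle-∉⇒∈ m m∉T
          where
          inX-m : ∀ {t} → t ∈ T → t ∈ X ─ ⁅ m ⁆
          inX-m t∈T = Y⊆X-m (T⊆Y t∈T)
          m∉T : m ∉ T
          m∉T m∈T = proj₂ (x∈p-y⁻ (inX-m m∈T)) refl
          T′⊆X : toggle m T ⊆ X
          T′⊆X t∈T′ with ∈-toggle⁻ m t∈T′
          ... | inj₁ refl = m∈X
          ... | inj₂ t∈T = proj₁ (x∈p-y⁻ (inX-m t∈T))
          free′ : ∀ x y → x ∈ toggle m T → y ∈ toggle m T → ¬ Between X x y
          free′ x y x∈T′ y∈T′ (w , w∈X , x<w , w<y) with ∈-toggle⁻ m x∈T′ | ∈-toggle⁻ m y∈T′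
          ... | inj₁ refl | inj₁ refl = irrefl refl (<-trans x<w w<y)
          ... | inj₁ refl | inj₂ y∈T = proj₂ (∈⟦⟧⁻ Y? (T⊆Y y∈T)) (w , w∈X , x<w , w<y)
          ... | inj₂ x∈T | inj₁ refl = m-min w∈X w<y
          ... | inj₂ x∈T | inj₂ y∈T = free x y x∈T y∈T (w , w∈Y , x<w , w<y)
            where
            x∈X : x ∈ X
            x∈X = proj₁ (x∈p-y⁻ (inX-m x∈T))
            w∈Y : w ∈ Y
            w∈Y = ∈⟦⟧⁺ Y? (x∈p∧x≢y⇒x∈p-y w∈X (λ { refl → m-min x∈X x<w }) ,
                           λ (u , u∈X , m<u , u<w) → proj₂ (∈⟦⟧⁻ Y? (T⊆Y y∈T)) (u , u∈X , m<u , <-trans u<w w<y))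

      ∣X-m∣<∣X∣ : ∣ X ─ ⁅ m ⁆ ∣ ℕ.< ∣ X ∣
      ∣X-m∣<∣X∣ = x∈p⇒∣p-x∣<∣p∣ m∈X

      ∣Y∣<∣X∣ : ∣ Y ∣ ℕ.< ∣ X ∣
      ∣Y∣<∣X∣ = ℕ.≤-<-trans (p⊆q⇒∣p∣≤∣q∣ Y⊆X-m) ∣X-m∣<∣X∣

      min[X-m]∈Y : ∀ {c} → c ∈ X ─ ⁅ m ⁆ → (∀ {w} → w ∈ X ─ ⁅ m ⁆ → ¬ w < c) → c ∈ Y
      min[X-m]∈Y c∈X-m c-min = ∈⟦⟧⁺ Y? (c∈X-m , λ (u , u∈X , m<u , u<c) →
        c-min (x∈p∧x≢y⇒x∈p-y u∈X (λ { refl → irrefl refl m<u })) u<c)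

      χ-Free-step : χ (Free? X) ≡ χ (Free? (X ─ ⁅ m ⁆)) - χ (Free? Y)
      χ-Free-step = begin
        χ (Free? X)
          ≡⟨ χ-split (Free? X) (m ∈?_) ⟩
        χ (Free? X ∩? (m ∈?_)) + χ (Free? X ∩? ∁? (m ∈?_))
          ≡⟨ cong₂ _+_ (χ-toggle (Free? X ∩? (m ∈?_)) m)
                       (χ-cong (Free? X ∩? ∁? (m ∈?_)) (Free? (X ─ ⁅ m ⁆)) Free-∌min) ⟩
        - χ (λ T → (Free? X ∩? (m ∈?_)) (toggle m T)) + χ (Free? (X ─ ⁅ m ⁆))
          ≡⟨ cong (λ z → - z + χ (Free? (X ─ ⁅ m ⁆)))
                  (χ-cong (λ T → (Free? X ∩? (m ∈?_)) (toggle m T)) (Free? Y) Free-∋min) ⟩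
        - χ (Free? Y) + χ (Free? (X ─ ⁅ m ⁆))
          ≡⟨ +-comm (- χ (Free? Y)) (χ (Free? (X ─ ⁅ m ⁆))) ⟩
        χ (Free? (X ─ ⁅ m ⁆)) - χ (Free? Y) ∎
        where open ≡-Reasoning

    Nonempty⇒χ-Free≡0 : ∀ {X} → Nonempty X → χ (Free? X) ≡ 0ℤ
    Nonempty⇒χ-Free≡0 {X} = go (On.wellFounded ∣_∣ <-wellFounded X)
      where
      wf : WellFounded _<_
      wf = spo-wellFounded isSPO
      go : ∀ {X} → Acc (ℕ._<_ on ∣_∣) X → Nonempty X → χ (Free? X) ≡ 0ℤ
      go {X} (acc smaller) (x , x∈X) with minimal _<?_ wf (_∈? X) x∈X
      ... | m , m∈X , m-min with nonempty? (X ─ ⁅ m ⁆)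
      ...   | no X-m-empty = trans (χ-Free-step m∈X m-min)
        (cong₂ _-_ (Empty⇒χ-Free≡1 X-m-empty)
                   (Empty⇒χ-Free≡1 (λ (y , y∈Y) → X-m-empty (y , Y⊆X-m m∈X m-min y∈Y))))
      ...   | yes (c , c∈X-m) with minimal _<?_ wf (_∈? X ─ ⁅ m ⁆) c∈X-m
      ...     | c′ , c′∈X-m , c′-min = trans (χ-Free-step m∈X m-min)
        (cong₂ _-_ (go (smaller (∣X-m∣<∣X∣ m∈X m-min)) (c , c∈X-m))
                   (go (smaller (∣Y∣<∣X∣ m∈X m-min)) (c′ , min[X-m]∈Y m∈X m-min c′∈X-m c′-min)))

  -- Convex sets of the double shelling antimatroid with a single interior point

  module WithDecidableOrder (P : FinPoset) (_≤?_ : Decidable₂ (FinPoset._≤_ P)) where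
    open FinPoset P
    open IsPartialOrder isPartialOrder using () renaming (refl to ≤-refl; trans to ≤-trans)
    open ToStrict _≡_ _≤_ using (_<_; <⇒≤; <-isStrictPartialOrder; <-decidable)

    El : Set
    El = Fin size

    <-isSPO : IsStrictPartialOrder _≡_ _<_
    <-isSPO = <-isStrictPartialOrder isPartialOrder
    open IsStrictPartialOrder <-isSPO using (irrefl; asym) renaming (trans to <-trans)

    _<?_ : Decidable₂ _<_
    _<?_ = <-decidable _≟ᶠ_ _≤?_

    open FreeSets <-isSPO _<?_

    Convex : Subset size → Set
    Convex C = ∀ {x y z} → x ∈ C → z ∈ C → x ≤ y → y ≤ z → y ∈ C

    IsConvex⇒Convex : ∀ {C} → IsConvex P C → Convex C
    IsConvex⇒Convex (I , J , I-ideal , J-filter , refl) x∈C z∈C x≤y y≤z = x∉p⇒x∈∁p λ y∈I∪J →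
      [ (λ y∈I → x∈∁p⇒x∉p x∈C (x∈p∪q⁺ (inj₁ (I-ideal x≤y y∈I))))
      , (λ y∈J → x∈∁p⇒x∉p z∈C (x∈p∪q⁺ (inj₂ (J-filter y≤z y∈J)))) ] (x∈p∪q⁻ I J y∈I∪J)

    Convex⇒IsConvex : ∀ {C} → Convex C → IsConvex P C
    Convex⇒IsConvex {C} convex = I , J , I-ideal , J-filter , ⊆-antisym C⊆∁[I∪J] ∁[I∪J]⊆C
      where
      below? : ∀ x → Dec (∃[ c ] (c ∈ C × x ≤ c))
      below? x = any? λ c → c ∈? C ×-dec x ≤? c
      I? : Decidable (λ x → x ∉ C × ∃[ c ] (c ∈ C × x ≤ c))
      I? x = ¬? (x ∈? C) ×-dec below? x
      J? : Decidable (λ x → x ∉ C × ¬ (∃[ c ] (c ∈ C × x ≤ c)))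
      J? x = ¬? (x ∈? C) ×-dec ¬? (below? x)
      I J : Subset size
      I = ⟦ I? ⟧
      J = ⟦ J? ⟧
      I-ideal : IsIdeal P I
      I-ideal {x} x≤y y∈I with ∈⟦⟧⁻ I? y∈I
      ... | y∉C , c , c∈C , y≤c =
        ∈⟦⟧⁺ I? ((λ x∈C → y∉C (convex x∈C c∈C x≤y y≤c)) , c , c∈C , ≤-trans x≤y y≤c)
      J-filter : IsFilter P J
      J-filter x≤y x∈J with ∈⟦⟧⁻ J? x∈J
      ... | x∉C , ¬below =
        ∈⟦⟧⁺ J? ((λ y∈C → ¬below (_ , y∈C , x≤y)) , λ (c , c∈C , y≤c) → ¬below (c , c∈C , ≤-trans x≤y y≤c))
      C⊆∁[I∪J] : C ⊆ ∁ (I ∪ J)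
      C⊆∁[I∪J] x∈C = x∉p⇒x∈∁p λ x∈I∪J →
        [ (λ x∈I → proj₁ (∈⟦⟧⁻ I? x∈I) x∈C) , (λ x∈J → proj₁ (∈⟦⟧⁻ J? x∈J) x∈C) ] (x∈p∪q⁻ I J x∈I∪J)
      ∁[I∪J]⊆C : ∁ (I ∪ J) ⊆ C
      ∁[I∪J]⊆C {x} x∈∁[I∪J] with x ∈? C | below? x
      ... | yes x∈C | _ = x∈C
      ... | no x∉C | yes below = ⊥-elim (x∈∁p⇒x∉p x∈∁[I∪J] (x∈p∪q⁺ (inj₁ (∈⟦⟧⁺ I? (x∉C , below)))))
      ... | no x∉C | no ¬below = ⊥-elim (x∈∁p⇒x∉p x∈∁[I∪J] (x∈p∪q⁺ (inj₂ (∈⟦⟧⁺ J? (x∉C , ¬below)))))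

    InnerPoint : Subset size → El → Set
    InnerPoint C p = p ∈ C × ∃[ x ] ∃[ z ] (x ∈ C × z ∈ C × x < p × p < z)

    InnerPoint? : ∀ C p → Dec (InnerPoint C p)
    InnerPoint? C p = p ∈? C ×-dec any? λ x → any? λ z → x ∈? C ×-dec (z ∈? C ×-dec (x <? p ×-dec p <? z))

    InnerPoint⇒IsInterior : ∀ {C p} → InnerPoint C p → IsInterior P C p
    InnerPoint⇒IsInterior {C} {p} (p∈C , x , z , x∈C , z∈C , x<p , p<z) =
      p∈C , λ (_ , p∉hull) → p∉hull p∈hull
      where
      p∈hull : InHull P (C ─ ⁅ p ⁆) p
      p∈hull D D-convex C-p⊆D = IsConvex⇒Convex D-convex
        (C-p⊆D (x∈p∧x≢y⇒x∈p-y x∈C (proj₂ x<p)))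
        (C-p⊆D (x∈p∧x≢y⇒x∈p-y z∈C (λ { refl → proj₂ p<z refl })))
        (<⇒≤ x<p) (<⇒≤ p<z)

    IsInterior⇒InnerPoint : ∀ {C p} → Convex C → IsInterior P C p → InnerPoint C p
    IsInterior⇒InnerPoint {C} {p} convex (p∈C , ¬extreme) with InnerPoint? C p
    ... | yes inner = inner
    ... | no ¬inner = ⊥-elim (¬extreme (p∈C , λ p∈hull → x∉p-x (p∈hull (C ─ ⁅ p ⁆) (Convex⇒IsConvex C-p-convex) id)))
      where
      C-p-convex : Convex (C ─ ⁅ p ⁆)
      C-p-convex x∈C-p z∈C-p x≤y y≤z with x∈p-y⁻ x∈C-p | x∈p-y⁻ z∈C-p
      ... | x∈C , x≢p | z∈C , z≢p = x∈p∧x≢y⇒x∈p-y (convex x∈C z∈C x≤y y≤z)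
        λ { refl → ¬inner (p∈C , _ , _ , x∈C , z∈C , (x≤y , x≢p) , (y≤z , λ p≡z → z≢p (sym p≡z))) }

    Pinched : Subset size → El → Set
    Pinched S p = ∀ x y z → x ∈ S → z ∈ S → x < y → y < z → y ≡ p

    SoleInterior : El → Pred (Subset size) 0ℓ
    SoleInterior p S = InnerPoint S p × Pinched S p

    SoleInterior? : ∀ p → Decidable (SoleInterior p)
    SoleInterior? p S = InnerPoint? S p ×-dec all? λ x → all? λ y → all? λ z →
      x ∈? S →-dec (z ∈? S →-dec (x <? y →-dec (y <? z →-dec y ≟ᶠ p)))

    InS⇒SoleInterior : ∀ {S} → InS P S → ∃[ p ] SoleInterior p S
    InS⇒SoleInterior (isConvex , p , interior , unique) = p , IsInterior⇒InnerPoint convex interior ,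
      λ x y z x∈S z∈S x<y y<z → unique y (InnerPoint⇒IsInterior
        (convex x∈S z∈S (<⇒≤ x<y) (<⇒≤ y<z) , x , z , x∈S , z∈S , x<y , y<z))
      where
      convex : Convex _
      convex = IsConvex⇒Convex isConvex

    SoleInterior⇒InS : ∀ {p S} → SoleInterior p S → InS P S
    SoleInterior⇒InS {p} {S} (inner , pinched) = Convex⇒IsConvex convex , p , InnerPoint⇒IsInterior inner ,
      λ q interior → let (_ , x , z , x∈S , z∈S , x<q , q<z) = IsInterior⇒InnerPoint convex interior
                     in pinched x q z x∈S z∈S x<q q<z
      where
      convex : Convex S
      convex {x} {y} {z} x∈S z∈S x≤y y≤z with x ≟ᶠ y | y ≟ᶠ z
      ... | yes refl | _ = x∈S
      ... | _ | yes refl = z∈S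
      ... | no x≢y | no y≢z = subst (_∈ S) (sym (pinched x y z x∈S z∈S (x≤y , x≢y) (y≤z , y≢z))) (proj₁ inner)

    SoleInterior-unique : ∀ {p q S} → SoleInterior p S → SoleInterior q S → p ≡ q
    SoleInterior-unique (_ , pinched) ((_ , x , z , x∈S , z∈S , x<q , q<z) , _) = sym (pinched x _ z x∈S z∈S x<q q<z)

    module AtPoint (p : El) where

      Adjacent : El → Set
      Adjacent x = x ≢ p × ¬ Between ⊤ x p × ¬ Between ⊤ p x

      Adjacent? : Decidable Adjacent
      Adjacent? x = ¬? (x ≟ᶠ p) ×-dec (¬? (Between? ⊤ x p) ×-dec ¬? (Between? ⊤ p x))

      X₀ : Subset size
      X₀ = ⟦ Adjacent? ⟧

      Below Above : Pred (Subset size) 0ℓ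
      Below T = ∃[ a ] (a ∈ T × a < p)
      Above T = ∃[ z ] (z ∈ T × p < z)

      Below? : Decidable Below
      Below? T = any? λ a → a ∈? T ×-dec a <? p

      Above? : Decidable Above
      Above? T = any? λ z → z ∈? T ×-dec p <? z

      SoleInterior-toggle : (λ T → SoleInterior p (toggle p T)) ≐ (λ T → Free X₀ T × Below T × Above T)
      SoleInterior-toggle = to , from
        where
        to : ∀ {T} → SoleInterior p (toggle p T) → Free X₀ T × Below T × Above T
        to {T} ((p∈S , a , z , a∈S , z∈S , a<p , p<z) , pinched) =
          (T⊆X₀ , free) ,
          (a , toggle-≢⁻ p (proj₂ a<p) a∈S , a<p) ,
          (z , toggle-≢⁻ p (λ { refl → irrefl refl p<z }) z∈S , p<z)
          where
          p∉T : p ∉ T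
          p∉T = toggle-∈⇒∉ p p∈S
          inS : ∀ {t} → t ∈ T → t ∈ toggle p T
          inS t∈T = toggle-≢⁺ p (λ { refl → p∉T t∈T }) t∈T
          T⊆X₀ : T ⊆ X₀
          T⊆X₀ {t} t∈T = ∈⟦⟧⁺ Adjacent? ((λ { refl → p∉T t∈T }) ,
            (λ (w , _ , t<w , w<p) → irrefl (pinched t w p (inS t∈T) p∈S t<w w<p) w<p) ,
            (λ (w , _ , p<w , w<t) → irrefl (sym (pinched p w t p∈S (inS t∈T) p<w w<t)) p<w))
          free : ∀ x y → x ∈ T → y ∈ T → ¬ Between X₀ x y
          free x y x∈T y∈T (w , w∈X₀ , x<w , w<y) =
            proj₁ (∈⟦⟧⁻ Adjacent? w∈X₀) (pinched x w y (inS x∈T) (inS y∈T) x<w w<y)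
        from : ∀ {T} → Free X₀ T × Below T × Above T → SoleInterior p (toggle p T)
        from {T} ((T⊆X₀ , free) , (a , a∈T , a<p) , (z , z∈T , p<z)) =
          (p∈S , a , z , inS a∈T , inS z∈T , a<p , p<z) , pinched
          where
          adjacent : ∀ {t} → t ∈ T → Adjacent t
          adjacent t∈T = ∈⟦⟧⁻ Adjacent? (T⊆X₀ t∈T)
          p∉T : p ∉ T
          p∉T p∈T = proj₁ (adjacent p∈T) refl
          p∈S : p ∈ toggle p T
          p∈S = toggle-∉⇒∈ p p∉T
          inS : ∀ {t} → t ∈ T → t ∈ toggle p T
          inS t∈T = toggle-≢⁺ p (λ { refl → p∉T t∈T }) t∈T
          pinched : Pinched (toggle p T) p
          pinched x y z x∈S z∈S x<y y<z with y ≟ᶠ p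
          ... | yes y≡p = y≡p
          ... | no y≢p with ∈-toggle⁻ p x∈S | ∈-toggle⁻ p z∈S
          ...   | inj₁ refl | inj₁ refl = ⊥-elim (asym x<y y<z)
          ...   | inj₁ refl | inj₂ z∈T = ⊥-elim (proj₂ (proj₂ (adjacent z∈T)) (y , ∈⊤ , x<y , y<z))
          ...   | inj₂ x∈T | inj₁ refl = ⊥-elim (proj₁ (proj₂ (adjacent x∈T)) (y , ∈⊤ , x<y , y<z))
          ...   | inj₂ x∈T | inj₂ z∈T = ⊥-elim (free x z x∈T z∈T (y , y∈X₀ , x<y , y<z))
            where
            y∈X₀ : y ∈ X₀
            y∈X₀ = ∈⟦⟧⁺ Adjacent? (y≢p ,
              (λ (w , _ , y<w , w<p) → proj₁ (proj₂ (adjacent x∈T)) (w , ∈⊤ , <-trans x<y y<w , w<p)) ,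
              (λ (w , _ , p<w , w<y) → proj₂ (proj₂ (adjacent z∈T)) (w , ∈⊤ , p<w , <-trans w<y y<z)))

      Comparable : El → Set
      Comparable x = x < p ⊎ p < x

      Comparable? : Decidable Comparable
      Comparable? x = x <? p ⊎-dec p <? x

      X₁ X₂ X₃ : Subset size
      X₁ = X₀ ∩ ⟦ ∁? (_<? p) ⟧
      X₂ = X₀ ∩ ⟦ ∁? (p <?_) ⟧
      X₃ = X₀ ∩ ⟦ ∁? Comparable? ⟧

      χ-avoiding-below : χ (Free? X₀ ∩? ∁? Below?) ≡ χ (Free? X₁)
      χ-avoiding-below = χ-cong (Free? X₀ ∩? ∁? Below?) (Free? X₁)
        (Free-avoiding (_<? p) λ ¬x<p _ x<y _ y<p → ¬x<p (<-trans x<y y<p))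

      χ-avoiding-above : χ (Free? X₀ ∩? ∁? Above?) ≡ χ (Free? X₂)
      χ-avoiding-above = χ-cong (Free? X₀ ∩? ∁? Above?) (Free? X₂)
        (Free-avoiding (p <?_) λ _ ¬p<z _ y<z p<y → ¬p<z (<-trans p<y y<z))

      χ-avoiding-both : χ (Free? X₀ ∩? ∁? Below? ∩? ∁? Above?) ≡ χ (Free? X₃)
      χ-avoiding-both = χ-cong (Free? X₀ ∩? ∁? Below? ∩? ∁? Above?) (Free? X₃)
        ((λ (free , ∄below , ∄above) → to (free , λ { (t , t∈T , inj₁ t<p) → ∄below (t , t∈T , t<p)
                                                     ; (t , t∈T , inj₂ p<t) → ∄above (t , t∈T , p<t) })) ,
         (λ free-X₃ → let (free , ∄comparable) = from free-X₃ in
           free , (λ (a , a∈T , a<p) → ∄comparable (a , a∈T , inj₁ a<p)) ,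
                   (λ (z , z∈T , p<z) → ∄comparable (z , z∈T , inj₂ p<z))))
        where
        incomparable-convex : ∀ {x y z} → ¬ Comparable x → ¬ Comparable z → x < y → y < z → ¬ Comparable y
        incomparable-convex ¬cx _ x<y _ (inj₁ y<p) = ¬cx (inj₁ (<-trans x<y y<p))
        incomparable-convex _ ¬cz _ y<z (inj₂ p<y) = ¬cz (inj₂ (<-trans p<y y<z))
        to : ∀ {T} → Free X₀ T × ¬ (∃[ t ] (t ∈ T × Comparable t)) → Free X₃ T
        to = proj₁ (Free-avoiding Comparable? incomparable-convex)
        from : ∀ {T} → Free X₃ T → Free X₀ T × ¬ (∃[ t ] (t ∈ T × Comparable t))
        from = proj₂ (Free-avoiding Comparable? incomparable-convex)

      χ-SoleInterior≡-χ-straddling : χ (SoleInterior? p) ≡ - χ (Free? X₀ ∩? Below? ∩? Above?)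
      χ-SoleInterior≡-χ-straddling = trans (χ-toggle (SoleInterior? p) p)
        (cong -_ (χ-cong (λ T → SoleInterior? p (toggle p T)) (Free? X₀ ∩? Below? ∩? Above?) SoleInterior-toggle))

      χ-SoleInterior≡ : χ (SoleInterior? p) ≡ - (χ (Free? X₀) - χ (Free? X₁) - χ (Free? X₂) + χ (Free? X₃))
      χ-SoleInterior≡ = begin
        χ (SoleInterior? p)
          ≡⟨ χ-SoleInterior≡-χ-straddling ⟩
        - χ (Free? X₀ ∩? Below? ∩? Above?)
          ≡⟨ cong -_ (χ-inclusion-exclusion (Free? X₀) Below? Above?) ⟩
        - (χ (Free? X₀) - χ (Free? X₀ ∩? ∁? Below?) - χ (Free? X₀ ∩? ∁? Above?)
             + χ (Free? X₀ ∩? ∁? Below? ∩? ∁? Above?))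
          ≡⟨ cong -_ (cong₂ _+_ (cong₂ _-_ (cong (λ k → χ (Free? X₀) - k) χ-avoiding-below) χ-avoiding-above)
                                χ-avoiding-both) ⟩
        - (χ (Free? X₀) - χ (Free? X₁) - χ (Free? X₂) + χ (Free? X₃)) ∎
        where open ≡-Reasoning

      χ-SoleInterior≡0 : (∀ T → ¬ (Below T × Above T)) → χ (SoleInterior? p) ≡ 0ℤ
      χ-SoleInterior≡0 ¬straddles = trans χ-SoleInterior≡-χ-straddling
        (cong -_ (χ-unsatisfiable (Free? X₀ ∩? Below? ∩? Above?) λ T (_ , straddles) → ¬straddles T straddles))

      ¬IsMinimal⇒below : ¬ IsMinimal P p → ∃[ a ] a < p
      ¬IsMinimal⇒below ¬min with any? (_<? p)
      ... | yes below = below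
      ... | no ∄below = ⊥-elim (¬min λ q q≤p → decidable-stable (q ≟ᶠ p) λ q≢p → ∄below (q , q≤p , q≢p))

      ¬IsMaximal⇒above : ¬ IsMaximal P p → ∃[ z ] p < z
      ¬IsMaximal⇒above ¬max with any? (p <?_)
      ... | yes above = above
      ... | no ∄above = ⊥-elim (¬max λ q p≤q → decidable-stable (p ≟ᶠ q) λ p≢q → ∄above (q , p≤q , p≢q))

      upper-cover : ∃[ z ] p < z → ∃[ u ] (p < u × u ∈ X₀)
      upper-cover (z , p<z) with minimal _<?_ (spo-wellFounded <-isSPO) (p <?_) p<z
      ... | u , p<u , u-min = u , p<u , ∈⟦⟧⁺ Adjacent? ((λ { refl → irrefl refl p<u }) ,
        (λ (w , _ , u<w , w<p) → asym p<u (<-trans u<w w<p)) ,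
        (λ (w , _ , p<w , w<u) → u-min p<w w<u))

      lower-cover : ∃[ a ] a < p → ∃[ l ] (l < p × l ∈ X₀)
      lower-cover (a , a<p) with minimal (flip _<?_) (po-noetherian isPartialOrder) (_<? p) a<p
      ... | l , l<p , l-max = l , l<p , ∈⟦⟧⁺ Adjacent? ((λ { refl → irrefl refl l<p }) ,
        (λ (w , _ , l<w , w<p) → l-max w<p l<w) ,
        (λ (w , _ , p<w , w<l) → asym l<p (<-trans p<w w<l)))

      χ-SoleInterior-bottleneck : IsBottleneck P p → χ (SoleInterior? p) ≡ - 1ℤ
      χ-SoleInterior-bottleneck (¬max , ¬min , comparable)
        with upper-cover (¬IsMaximal⇒above ¬max) | lower-cover (¬IsMinimal⇒below ¬min)
      ... | u , p<u , u∈X₀ | l , l<p , l∈X₀ = trans χ-SoleInterior≡ (cong -_ (cong₂ _+_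
            (cong₂ _-_ (cong₂ _-_ (Nonempty⇒χ-Free≡0 (u , u∈X₀)) (Nonempty⇒χ-Free≡0 (u , u∈X₁)))
                       (Nonempty⇒χ-Free≡0 (l , l∈X₂)))
            (Empty⇒χ-Free≡1 X₃-empty)))
        where
        u∈X₁ : u ∈ X₁
        u∈X₁ = x∈p∩q⁺ (u∈X₀ , ∈⟦⟧⁺ (∁? (_<? p)) (asym p<u))
        l∈X₂ : l ∈ X₂
        l∈X₂ = x∈p∩q⁺ (l∈X₀ , ∈⟦⟧⁺ (∁? (p <?_)) (asym l<p))
        X₃-empty : Empty X₃
        X₃-empty (x , x∈X₃) with x∈p∩q⁻ X₀ _ x∈X₃
        ... | x∈X₀ , x-incomparable = ∈⟦⟧⁻ (∁? Comparable?) x-incomparable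
              ([ (λ p≤x → inj₂ (p≤x , λ { refl → x≢p refl })) , (λ x≤p → inj₁ (x≤p , x≢p)) ] (comparable x))
          where
          x≢p : x ≢ p
          x≢p = proj₁ (∈⟦⟧⁻ Adjacent? x∈X₀)

      χ-SoleInterior-not-bottleneck : ¬ IsBottleneck P p → χ (SoleInterior? p) ≡ 0ℤ
      χ-SoleInterior-not-bottleneck ¬bottleneck
        with any? (_<? p) | any? (p <?_) | all? (λ q → p ≤? q ⊎-dec q ≤? p)
      ... | no ∄below | _ | _ = χ-SoleInterior≡0 λ _ ((a , _ , a<p) , _) → ∄below (a , a<p)
      ... | yes _ | no ∄above | _ = χ-SoleInterior≡0 λ _ (_ , (z , _ , p<z)) → ∄above (z , p<z)
      ... | yes (a , a<p) | yes (z , p<z) | yes comparable = ⊥-elim (¬bottleneck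
            ((λ max → proj₂ p<z (max z (<⇒≤ p<z))) , (λ min → proj₂ a<p (min a (<⇒≤ a<p))) , comparable))
      ... | yes _ | yes _ | no ¬comparable with ¬∀⟶∃¬ size _ (λ q → p ≤? q ⊎-dec q ≤? p) ¬comparable
      ...   | q , incomparable = trans χ-SoleInterior≡ (cong -_ (cong₂ _+_
              (cong₂ _-_ (cong₂ _-_ (Nonempty⇒χ-Free≡0 (q , q∈X₀)) (Nonempty⇒χ-Free≡0 (q , q∈X₁)))
                         (Nonempty⇒χ-Free≡0 (q , q∈X₂)))
              (Nonempty⇒χ-Free≡0 (q , q∈X₃))))
        where
        q∈X₀ : q ∈ X₀
        q∈X₀ = ∈⟦⟧⁺ Adjacent? ((λ { refl → incomparable (inj₁ ≤-refl) }) ,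
          (λ (w , _ , q<w , w<p) → incomparable (inj₂ (<⇒≤ (<-trans q<w w<p)))) ,
          (λ (w , _ , p<w , w<q) → incomparable (inj₁ (<⇒≤ (<-trans p<w w<q)))))
        ¬comparable-q : ¬ Comparable q
        ¬comparable-q (inj₁ q<p) = incomparable (inj₂ (<⇒≤ q<p))
        ¬comparable-q (inj₂ p<q) = incomparable (inj₁ (<⇒≤ p<q))
        q∈X₁ : q ∈ X₁
        q∈X₁ = x∈p∩q⁺ (q∈X₀ , ∈⟦⟧⁺ (∁? (_<? p)) (λ q<p → ¬comparable-q (inj₁ q<p)))
        q∈X₂ : q ∈ X₂
        q∈X₂ = x∈p∩q⁺ (q∈X₀ , ∈⟦⟧⁺ (∁? (p <?_)) (λ p<q → ¬comparable-q (inj₂ p<q)))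
        q∈X₃ : q ∈ X₃
        q∈X₃ = x∈p∩q⁺ (q∈X₀ , ∈⟦⟧⁺ (∁? Comparable?) ¬comparable-q)

      χ-SoleInterior : (d : Dec (IsBottleneck P p)) → χ (SoleInterior? p) ≡ - ([ d ]· 1ℤ)
      χ-SoleInterior (yes bottleneck) = χ-SoleInterior-bottleneck bottleneck
      χ-SoleInterior (no ¬bottleneck) = χ-SoleInterior-not-bottleneck ¬bottleneck

    open AtPoint using (χ-SoleInterior)

    sum-sign : (B : List El) → Unique B → (∀ p → (p ∈ᴸ B) ⇔ IsBottleneck P p)
             → (𝒮 : List (Subset size)) → Unique 𝒮 → (∀ S → (S ∈ᴸ 𝒮) ⇔ InS P S)
             → sumℤ (map sign 𝒮) ≡ - (+ length B)
    sum-sign B uB B⇔bottleneck 𝒮 u𝒮 𝒮⇔InS = begin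
      sumℤ (map sign 𝒮)
        ≡⟨ SubsetSum.sum-map≡∑ _≟ₛ_ ∑ₛ-δ 𝒮 u𝒮 sign ⟩
      ∑ₛ (λ S → [ DecMembership._∈?_ _≟ₛ_ S 𝒮 ]· sign S)
        ≡⟨ ∑ₛ-cong split-by-interior ⟩
      ∑ₛ (λ S → sum (λ p → [ SoleInterior? p S ]· sign S))
        ≡⟨ ∑ₛ-∑ᶠ (λ p S → [ SoleInterior? p S ]· sign S) ⟩
      sum (λ p → χ (SoleInterior? p))
        ≡⟨ sum-cong-≗ (λ p → χ-SoleInterior p (Dec.map (B⇔bottleneck p) (p ∈ᴮ? B))) ⟩
      sum (λ p → - ([ p ∈ᴮ? B ]· 1ℤ))
        ≡⟨ FinSum.∑-neg (λ p → [ p ∈ᴮ? B ]· 1ℤ) ⟩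
      - sum (λ p → [ p ∈ᴮ? B ]· 1ℤ)
        ≡⟨ cong -_ (sym (FinSum.sum-map≡∑ _≟ᶠ_ ∑ᶠ-δ B uB (λ _ → 1ℤ))) ⟩
      - sumℤ (map (λ _ → 1ℤ) B)
        ≡⟨ cong -_ (sum-ones B) ⟩
      - (+ length B) ∎
      where
      open ≡-Reasoning
      _∈ᴮ?_ : ∀ p (L : List El) → Dec (p ∈ᴸ L)
      _∈ᴮ?_ = DecMembership._∈?_ _≟ᶠ_
      split-by-interior : ∀ S → [ DecMembership._∈?_ _≟ₛ_ S 𝒮 ]· sign S ≡
                                sum (λ p → [ SoleInterior? p S ]· sign S)
      split-by-interior S = sym (trans (∑ᶠ-[]·-unique (λ p → SoleInterior? p S) SoleInterior-unique (sign S))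
        ([]·-cong (any? (λ p → SoleInterior? p S)) (DecMembership._∈?_ _≟ₛ_ S 𝒮)
                  (λ (_ , sole) → Equivalence.from (𝒮⇔InS S) (SoleInterior⇒InS sole))
                  (λ S∈𝒮 → InS⇒SoleInterior (Equivalence.to (𝒮⇔InS S) S∈𝒮)) (sign S)))

open import Data.List.Membership.Propositional using (_∈_)

¬¬-∀-Fin : ∀ {n ℓ} {Q : Fin n → Set ℓ} → (∀ i → ¬ ¬ Q i) → ¬ ¬ (∀ i → Q i)
¬¬-∀-Fin {zero} _ ¬∀ = ¬∀ λ ()
¬¬-∀-Fin {suc n} ¬¬Q ¬∀ = ¬¬Q zero λ Q₀ → ¬¬-∀-Fin (λ i → ¬¬Q (suc i)) λ Qₛ →
  ¬∀ λ { zero → Q₀ ; (suc i) → Qₛ i }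

¬¬-decidable : ∀ {n ℓ} (R : Rel (Fin n) ℓ) → ¬ ¬ Decidable₂ R
¬¬-decidable R = ¬¬-∀-Fin λ x → ¬¬-∀-Fin λ y → ¬¬-excluded-middle

theorem4p9 : (P : FinPoset)
    → (B : List (Fin (FinPoset.size P))) → Unique B
    → (∀ p → (p ∈ B) ⇔ IsBottleneck P p)
    → (𝒮 : List (Subset (FinPoset.size P))) → Unique 𝒮
    → (∀ S → (S ∈ 𝒮) ⇔ InS P S)
    → sumℤ (map sign 𝒮) ≡ - (+ length B)
-- _≤_ need not be decidable, but a relation on a finite set is decidable up to double negation,
-- and the goal, an equation in ℤ, is stable under double negation.
theorem4p9 P B uB B⇔bottleneck 𝒮 u𝒮 𝒮⇔InS =
  decidable-stable (sumℤ (map sign 𝒮) ≟ℤ - (+ length B))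
    (¬¬-map (λ _≤?_ → WithDecidableOrder.sum-sign P _≤?_ B uB B⇔bottleneck 𝒮 u𝒮 𝒮⇔InS)
            (¬¬-decidable (FinPoset._≤_ P)))
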